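{- Let $n\ge 4$ be even and $k$ an integer. Then $v_1,\ldots,v_n,v_1$ is a Hamiltonian cycle of $\mathrm{CP}(k,n)$ if and only if $v_1+\varphi(n),\ldots,v_n+\varphi(n),v_1+\varphi(n)$ is a Hamiltonian cycle of $\mathrm{CP}(k+\varphi(n),n)$.
   Context: For an integer $k$ and a positive integer $n$, $\mathrm{CP}(k,n)$ is the simple graph with vertex set $\{k,k+1,\ldots,k+n-1\}$ in which two distinct vertices $a,b$ are adjacent if and only if $\gcd(a,b)=1$ (with $\gcd(a,0)=|a|$). For a positive integer $n$, $\varphi(n)$ denotes the product of all odd primes less than $n$. -}

module Defs where

open import Data.Nat as ℕ using (ℕ; zero; suc)
open import Data.Nat.Primality using (prime?)
open import Data.Integer as ℤ using (ℤ; +_; _+_; _≤_; _<_)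
open import Data.Integer.GCD using (gcd)
open import Data.Fin using (Fin; inject₁; fromℕ)
import Data.Fin as F
open import Data.Bool using (if_then_else_; _∧_)
open import Data.Product using (_×_; ∃)
open import Data.Empty using (⊥)
open import Relation.Nullary using (¬_)
open import Relation.Nullary.Decidable using (⌊_⌋)
open import Relation.Binary.PropositionalEquality using (_≡_)
open import Function.Definitions using (Injective)

isOddPrime : ℕ → Data.Bool.Bool
isOddPrime m = ⌊ prime? m ⌋ ∧ ⌊ (m ℕ.% 2) ℕ.≟ 1 ⌋

φ : ℕ → ℕ
φ zero = 1
φ (suc m) = φ m ℕ.* (if isOddPrime m then m else 1)

InCP : ℤ → ℕ → ℤ → Set
InCP k n x = k ≤ x × x < k + + n

-- adjacency in CP(k,n) (for vertices of the graph): distinct and coprime,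
-- with gcd a 0 = |a| (as Data.Integer.GCD.gcd)
Adj : ℤ → ℤ → Set
Adj a b = ¬ (a ≡ b) × gcd a b ≡ + 1

CycleAdj : (n : ℕ) → (Fin n → ℤ) → Set
CycleAdj zero v = ⊥
CycleAdj (suc m) v =
  ((i : Fin m) → Adj (v (inject₁ i)) (v (F.suc i))) × Adj (v (fromℕ m)) (v F.zero)

IsHamCycleCP : (k : ℤ) (n : ℕ) → (Fin n → ℤ) → Set
IsHamCycleCP k n v =
  ((i : Fin n) → InCP k n (v i)) ×
  Injective _≡_ _≡_ v ×
  ((x : ℤ) → InCP k n x → ∃ λ i → v i ≡ x) ×
  CycleAdj n v

-- Put P = φ(n); it is odd and divisible by every odd prime below n.  When n is even, a Hamiltonian
-- cycle of CP(k, n) alternates in parity: the n/2 even vertices are pairwise non-adjacent, so each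
-- is followed by an odd one, and these already account for all n/2 odd vertices.  Now let a, b be
-- consecutive on the cycle and p a prime dividing a + P and b + P.  Then p ∣ a − b, so p < n;
-- p ≠ 2 since a + P and b + P have opposite parity, and an odd p divides P, hence a and b,
-- contradicting gcd(a, b) = 1.  The converse is the same argument for the shift by −P.
module Submission where

open import Data.Bool using (true; false; if_then_else_)
open import Data.Bool.Properties using (T-≡; T-∧)
open import Data.Fin using (Fin; zero; suc; inject₁; fromℕ; punchOut)
open import Data.Fin.Properties using (suc-injective; punchOut-injective; injective⇒≤)
open import Data.Integer using (ℤ; +_; _+_; _-_; -_; _*_; ∣_∣)
import Data.Integer as ℤ using (_<_)
import Data.Integer.DivMod as ℤ
open import Data.Integer.Divisibility.Signed as ℤ∣ using (divides)
open import Data.Integer.GCD using (gcd; gcd-greatest)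
import Data.Integer.Properties as ℤ
open import Algebra.Properties.AbelianGroup ℤ.+-0-abelianGroup
  using () renaming (∙-cancelʳ to +-cancelʳ)
open import Data.Integer.Tactic.RingSolver using (solve-∀)
open import Data.List using ([]; _∷_)
open import Data.List.Relation.Unary.All using (_∷_)
open import Data.Nat as ℕ using (ℕ; zero; suc; _≤_; _<_; s≤s; NonZero)
open import Data.Nat.DivMod using (_%_; m%n<n)
open import Data.Nat.Divisibility using (_∣_)
import Data.Nat.Divisibility as ℕ
import Data.Nat.GCD as ℕ
import Data.Nat.Properties as ℕ
open import Data.Nat.Primality
  using (Prime; prime?; euclidsLemma; prime[2]; prime⇒irreducible; ¬prime[1])
open import Data.Nat.Primality.Factorisation using (factorise)
open import Data.Product using (_×_; _,_; ∃; proj₁; proj₂)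
open import Data.Sum using (inj₁; inj₂)
open import Function.Bundles using (_⇔_; mk⇔; Equivalence)
open import Function.Definitions using (Injective)
open import Relation.Nullary using (¬_; Dec; yes; no; contradiction)
open import Relation.Nullary.Decidable using (⌊_⌋; toWitness; fromWitness)
open import Relation.Binary.PropositionalEquality

open import Defs

Even Odd : ℤ → Set
Even x = + 2 ℤ∣.∣ x
Odd x = ¬ Even x

even? : ∀ x → Dec (Even x)
even? x = + 2 ℤ∣.∣? x

¬2∣1 : ¬ 2 ∣ 1
¬2∣1 2∣1 = contradiction (ℕ.∣1⇒≡1 2∣1) λ ()

odd⇒even[+1] : ∀ {x} → Odd x → Even (x + + 1)
odd⇒even[+1] {x} odd with x ℤ.% + 2 | ℤ.n%d<d x (+ 2) | ℤ.a≡a%n+[a/n]*n x (+ 2)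
... | 0 | _ | x≡ = contradiction (divides (x ℤ./ + 2) (trans x≡ (ℤ.+-identityˡ _))) odd
... | suc (suc _) | s≤s (s≤s ()) | _
... | 1 | _ | x≡ = divides (x ℤ./ + 2 + + 1) (trans (cong (_+ + 1) x≡) (regroup (x ℤ./ + 2)))
  where
  regroup : ∀ q → + 1 + q * + 2 + + 1 ≡ (q + + 1) * + 2
  regroup = solve-∀

odd⇒even[-1] : ∀ {x} → Odd x → Even (x - + 1)
odd⇒even[-1] {x} odd = subst Even (regroup x) (ℤ∣.∣m∣n⇒∣m-n (odd⇒even[+1] odd) ℤ∣.∣-refl)
  where
  regroup : ∀ x → x + + 1 - + 2 ≡ x - + 1
  regroup = solve-∀

even⇒even[+2] : ∀ {x} → Even x → Even (x + + 2)
even⇒even[+2] e = ℤ∣.∣m∣n⇒∣m+n e ℤ∣.∣-refl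

odd-neg : ∀ {x} → Odd x → Odd (- x)
odd-neg {x} odd e = odd (subst Even (ℤ.neg-involutive x) (ℤ∣.∣m⇒∣-m e))

even[+odd]⇒odd : ∀ {a s} → Odd s → Even (a + s) → Odd a
even[+odd]⇒odd odd e ea = odd (ℤ∣.∣m+n∣m⇒∣n e ea)

even∧even⇒gcd≢1 : ∀ {a b} → Even a → Even b → gcd a b ≢ + 1
even∧even⇒gcd≢1 {a} {b} ea eb gcd≡1 =
  ¬2∣1 (subst (λ g → 2 ∣ ∣ g ∣) gcd≡1 (gcd-greatest {a} {b} {+ 2} (ℤ∣.∣⇒∣ᵤ ea) (ℤ∣.∣⇒∣ᵤ eb)))

odd-prime⇒%2≡1 : ∀ {p} → Prime p → p ≢ 2 → p % 2 ≡ 1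
odd-prime⇒%2≡1 {p} pp p≢2 with p % 2 in p%2 | m%n<n p 2
... | 1 | _ = refl
... | suc (suc _) | s≤s (s≤s ())
... | 0 | _ with prime⇒irreducible pp (ℕ.m%n≡0⇒n∣m p 2 p%2)
...   | inj₁ ()
...   | inj₂ 2≡p = contradiction (sym 2≡p) p≢2

isOddPrime⇒%2≡1 : ∀ {m} → isOddPrime m ≡ true → m % 2 ≡ 1
isOddPrime⇒%2≡1 {m} isOdd = toWitness {a? = m % 2 ℕ.≟ 1}
  (proj₂ (Equivalence.to (T-∧ {⌊ prime? m ⌋}) (Equivalence.from T-≡ isOdd)))

odd-prime⇒isOddPrime : ∀ {p} → Prime p → p ≢ 2 → isOddPrime p ≡ true
odd-prime⇒isOddPrime {p} pp p≢2 =
  Equivalence.to T-≡ (Equivalence.from (T-∧ {⌊ prime? p ⌋} {⌊ p % 2 ℕ.≟ 1 ⌋})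
    (fromWitness pp , fromWitness (odd-prime⇒%2≡1 pp p≢2)))

¬2∣φ : ∀ n → ¬ 2 ∣ φ n
¬2∣φ zero = ¬2∣1
¬2∣φ (suc m) 2∣φ with euclidsLemma (φ m) (if isOddPrime m then m else 1) prime[2] 2∣φ
... | inj₁ 2∣φm = ¬2∣φ m 2∣φm
... | inj₂ 2∣factor = ¬2∣factor 2∣factor
  where
  ¬2∣factor : ¬ 2 ∣ (if isOddPrime m then m else 1)
  ¬2∣factor with isOddPrime m in isOdd
  ... | false = ¬2∣1
  ... | true = λ 2∣m →
    contradiction (trans (sym (ℕ.n∣m⇒m%n≡0 m 2 2∣m)) (isOddPrime⇒%2≡1 {m} isOdd)) λ ()

odd-prime∣φ : ∀ n {p} → Prime p → p ≢ 2 → p < n → p ∣ φ n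
odd-prime∣φ (suc m) {p} pp p≢2 (s≤s p≤m) with p ℕ.≟ m
... | no p≢m = ℕ.∣-trans (odd-prime∣φ m pp p≢2 (ℕ.≤∧≢⇒< p≤m p≢m)) (ℕ.m∣m*n _)
... | yes refl rewrite odd-prime⇒isOddPrime pp p≢2 = ℕ.n∣m*n (φ p)

noPrimeDivisor⇒≡1 : ∀ g .{{_ : NonZero g}} → (∀ {p} → Prime p → ¬ p ∣ g) → g ≡ 1
noPrimeDivisor⇒≡1 g noPrime with factorise g
... | record { factors = [] ; isFactorisation = g≡1 } = g≡1
... | record { factors = p ∷ _ ; isFactorisation = g≡p*_ ; factorsPrime = pp ∷ _ } =
  contradiction (subst (p ∣_) (sym g≡p*_) (ℕ.m∣m*n _)) (noPrime pp)

DivisibleByOddPrimesBelow : ℕ → ℤ → Set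
DivisibleByOddPrimesBelow n s = ∀ {p} → Prime p → p ≢ 2 → p < n → + p ℤ∣.∣ s

DivisibleByOddPrimesBelow-neg : ∀ {n s} →
  DivisibleByOddPrimesBelow n s → DivisibleByOddPrimesBelow n (- s)
DivisibleByOddPrimesBelow-neg s-div pp p≢2 p<n = ℤ∣.∣m⇒∣-m (s-div pp p≢2 p<n)

gcd[+s,+s]≡1 : ∀ {n s a b} → Odd s → DivisibleByOddPrimesBelow n s →
  a ≢ b → ∣ a - b ∣ < n → ¬ (Odd a × Odd b) → gcd a b ≡ + 1 → gcd (a + s) (b + s) ≡ + 1
gcd[+s,+s]≡1 {n} {s} {a} {b} odd-s s-div a≢b ∣a-b∣<n ¬odd∧odd gcd≡1 =
  cong +_ (noPrimeDivisor⇒≡1 g {{ℕ.≢-nonZero gcd≢0}} ¬prime∣gcd)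
  where
  g : ℕ
  g = ℕ.gcd ∣ a + s ∣ ∣ b + s ∣

  a+s≢b+s : a + s ≢ b + s
  a+s≢b+s eq = a≢b (+-cancelʳ s a b eq)

  gcd≢0 : g ≢ 0
  gcd≢0 gcd≡0 = a+s≢b+s (trans (ℤ.∣i∣≡0⇒i≡0 (ℕ.gcd[m,n]≡0⇒m≡0 gcd≡0))
                               (sym (ℤ.∣i∣≡0⇒i≡0 (ℕ.gcd[m,n]≡0⇒n≡0 ∣ a + s ∣ gcd≡0))))

  difference : ∀ a b s → (a + s) - (b + s) ≡ a - b
  difference = solve-∀

  ∣g⇒∣both : ∀ {d} → d ∣ g → + d ℤ∣.∣ a + s × + d ℤ∣.∣ b + s
  ∣g⇒∣both d∣g =
    ℤ∣.∣ᵤ⇒∣ (ℕ.∣-trans d∣g (ℕ.gcd[m,n]∣m ∣ a + s ∣ ∣ b + s ∣)) ,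
    ℤ∣.∣ᵤ⇒∣ (ℕ.∣-trans d∣g (ℕ.gcd[m,n]∣n ∣ a + s ∣ ∣ b + s ∣))

  ¬prime∣gcd : ∀ {p} → Prime p → ¬ p ∣ g
  ¬prime∣gcd {p} pp p∣g with ∣g⇒∣both p∣g | p ℕ.≟ 2
  ... | p∣a+s , p∣b+s | yes refl =
    ¬odd∧odd (even[+odd]⇒odd odd-s p∣a+s , even[+odd]⇒odd odd-s p∣b+s)
  ... | p∣a+s , p∣b+s | no p≢2 = ¬prime[1] (subst Prime (ℕ.∣1⇒≡1 p∣1) pp)
    where
    p∣a-b : p ∣ ∣ a - b ∣
    p∣a-b = ℤ∣.∣⇒∣ᵤ (subst (+ p ℤ∣.∣_) (difference a b s) (ℤ∣.∣m∣n⇒∣m-n p∣a+s p∣b+s))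
    ∣a-b∣≢0 : ∣ a - b ∣ ≢ 0
    ∣a-b∣≢0 eq = a≢b (ℤ.i-j≡0⇒i≡j a b (ℤ.∣i∣≡0⇒i≡0 eq))
    p∣s : + p ℤ∣.∣ s
    p∣s = s-div pp p≢2 (ℕ.≤-<-trans (ℕ.∣⇒≤ {{ℕ.≢-nonZero ∣a-b∣≢0}} p∣a-b) ∣a-b∣<n)
    p∣1 : p ∣ 1
    p∣1 = subst (λ g → p ∣ ∣ g ∣) gcd≡1 (gcd-greatest {a} {b} {+ p}
      (ℤ∣.∣⇒∣ᵤ (ℤ∣.∣m+n∣n⇒∣m {m = a} p∣a+s p∣s)) (ℤ∣.∣⇒∣ᵤ (ℤ∣.∣m+n∣n⇒∣m {m = b} p∣b+s p∣s)))

data LastOrInject₁ : ∀ {m} → Fin (suc m) → Set where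
  last : ∀ {m} → LastOrInject₁ (fromℕ m)
  inject : ∀ {m} (i : Fin m) → LastOrInject₁ (inject₁ i)

lastOrInject₁ : ∀ {m} (p : Fin (suc m)) → LastOrInject₁ p
lastOrInject₁ {zero} zero = last
lastOrInject₁ {suc m} zero = inject zero
lastOrInject₁ {suc m} (suc p) with lastOrInject₁ p
... | last = last
... | inject i = inject (suc i)

next : ∀ {m} → Fin (suc m) → Fin (suc m)
next p with lastOrInject₁ p
... | last = zero
... | inject i = suc i

lastOrInject₁-inject₁ : ∀ {m} (i : Fin m) → lastOrInject₁ (inject₁ i) ≡ inject i
lastOrInject₁-inject₁ {suc m} zero = refl
lastOrInject₁-inject₁ {suc m} (suc i) rewrite lastOrInject₁-inject₁ i = refl

lastOrInject₁-fromℕ : ∀ m → lastOrInject₁ (fromℕ m) ≡ last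
lastOrInject₁-fromℕ zero = refl
lastOrInject₁-fromℕ (suc m) rewrite lastOrInject₁-fromℕ m = refl

next-inject₁ : ∀ {m} (i : Fin m) → next (inject₁ i) ≡ suc i
next-inject₁ i rewrite lastOrInject₁-inject₁ i = refl

next-fromℕ : ∀ m → next (fromℕ m) ≡ zero
next-fromℕ m rewrite lastOrInject₁-fromℕ m = refl

next-injective : ∀ {m} → Injective _≡_ _≡_ (next {m})
next-injective {x = p} {q} with lastOrInject₁ p | lastOrInject₁ q
... | last | last = λ _ → refl
... | last | inject _ = λ ()
... | inject _ | last = λ ()
... | inject _ | inject _ = λ eq → cong inject₁ (suc-injective eq)

cycleAdj⇒Adj-next : ∀ {m} {v : Fin (suc m) → ℤ} →
  CycleAdj (suc m) v → ∀ p → Adj (v p) (v (next p))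
cycleAdj⇒Adj-next (adj , adj-last) p with lastOrInject₁ p
... | last = adj-last
... | inject i = adj i

Adj-next⇒cycleAdj : ∀ {m} {v : Fin (suc m) → ℤ} →
  (∀ p → Adj (v p) (v (next p))) → CycleAdj (suc m) v
Adj-next⇒cycleAdj {m} {v} adj =
  (λ i → subst (λ q → Adj (v (inject₁ i)) (v q)) (next-inject₁ i) (adj (inject₁ i))) ,
  subst (λ q → Adj (v (fromℕ m)) (v q)) (next-fromℕ m) (adj (fromℕ m))

injective⇒¬omits : ∀ {n} {f : Fin n → Fin n} → Injective _≡_ _≡_ f → ∀ z → ¬ (∀ i → f i ≢ z)
injective⇒¬omits {suc m} {f} f-inj z omits = ℕ.1+n≰n (injective⇒≤ {f = f′} f′-inj)
  where
  z≢f : ∀ i → z ≢ f i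
  z≢f i z≡fi = omits i (sym z≡fi)
  f′ : Fin (suc m) → Fin m
  f′ i = punchOut (z≢f i)
  f′-inj : Injective _≡_ _≡_ f′
  f′-inj {x} {y} eq = f-inj (punchOut-injective (z≢f x) (z≢f y) eq)

i+j-i≡j : ∀ i j → i + j - i ≡ j
i+j-i≡j = solve-∀

i+[j-i]≡j : ∀ i j → i + (j - i) ≡ j
i+[j-i]≡j = solve-∀

i+j-j≡i : ∀ i j → i + j - j ≡ i
i+j-j≡i = solve-∀

i-j+j≡i : ∀ i j → i - j + j ≡ i
i-j+j≡i = solve-∀

InCP⇒offset : ∀ {k n x} → InCP k n x → ∃ λ α → α < n × x ≡ k + + α
InCP⇒offset {k} {n} {x} (k≤x , x<k+n) = ∣ x - k ∣ , ℤ.drop‿+<+ ∣x-k∣<n , x≡k+∣x-k∣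
  where
  +∣x-k∣≡x-k : + ∣ x - k ∣ ≡ x - k
  +∣x-k∣≡x-k = ℤ.0≤i⇒+∣i∣≡i (ℤ.i≤j⇒0≤j-i k≤x)
  x≡k+∣x-k∣ : x ≡ k + + ∣ x - k ∣
  x≡k+∣x-k∣ = trans (sym (i+[j-i]≡j k x)) (cong (λ d → k + d) (sym +∣x-k∣≡x-k))
  ∣x-k∣<n : + ∣ x - k ∣ ℤ.< + n
  ∣x-k∣<n = subst₂ ℤ._<_ (sym +∣x-k∣≡x-k) (i+j-i≡j k (+ n)) (ℤ.+-monoˡ-< (- k) x<k+n)

offset⇒InCP : ∀ {k n α} → α < n → InCP k n (k + + α)
offset⇒InCP {k} {n} {α} α<n = ℤ.i≤i+j k (+ α) , ℤ.+-monoʳ-< k (ℤ.+<+ α<n)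

InCP⇒∣-∣<n : ∀ {k n a b} → InCP k n a → InCP k n b → ∣ a - b ∣ < n
InCP⇒∣-∣<n {k} a∈ b∈ with InCP⇒offset a∈ | InCP⇒offset b∈
... | α , α<n , refl | β , β<n , refl = ℕ.≤-<-trans ∣a-b∣≤α⊔β (ℕ.⊔-lub α<n β<n)
  where
  difference : ∀ k i j → (k + i) - (k + j) ≡ i - j
  difference = solve-∀
  ∣a-b∣≤α⊔β : ∣ (k + + α) - (k + + β) ∣ ℕ.≤ α ℕ.⊔ β
  ∣a-b∣≤α⊔β = subst (λ d → ∣ d ∣ ℕ.≤ α ℕ.⊔ β)
    (sym (trans (difference k (+ α) (+ β)) (ℤ.m-n≡m⊖n α β))) (ℤ.∣m⊝n∣≤m⊔n α β)

InCP-+ : ∀ {k n x} s → InCP k n x → InCP (k + s) n (x + s)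
InCP-+ {k} {n} {x} s (k≤x , x<k+n) =
  ℤ.+-monoˡ-≤ s k≤x , subst (x + s ℤ.<_) (swap k (+ n) s) (ℤ.+-monoˡ-< s x<k+n)
  where
  swap : ∀ k n s → k + n + s ≡ k + s + n
  swap = solve-∀

partner : ℤ → ℤ → ℤ
partner k x with even? (x - k)
... | yes _ = x + + 1
... | no _ = x - + 1

odd⇒even-partner : ∀ k {x} → Odd x → Even (partner k x)
odd⇒even-partner k {x} odd with even? (x - k)
... | yes _ = odd⇒even[+1] odd
... | no _ = odd⇒even[-1] odd

even-gap : ∀ k {x y} → Even (x - k) → x + + 1 ≡ y - + 1 → Even (y - k)
even-gap k {x} {y} even x+1≡y-1 = subst Even y-k≡ (even⇒even[+2] even)
  where
  open ≡-Reasoning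
  regroup : ∀ x k → x - k + + 2 ≡ x + + 1 - k + + 1
  regroup = solve-∀
  unshift : ∀ y k → y - + 1 - k + + 1 ≡ y - k
  unshift = solve-∀
  y-k≡ : x - k + + 2 ≡ y - k
  y-k≡ = begin
    x - k + + 2        ≡⟨ regroup x k ⟩
    x + + 1 - k + + 1  ≡⟨ cong (λ t → t - k + + 1) x+1≡y-1 ⟩
    y - + 1 - k + + 1  ≡⟨ unshift y k ⟩
    y - k              ∎

partner-injective : ∀ k → Injective _≡_ _≡_ (partner k)
partner-injective k {x} {y} with even? (x - k) | even? (y - k)
... | yes _ | yes _ = +-cancelʳ (+ 1) x y
... | no _ | no _ = +-cancelʳ (- + 1) x y
... | yes even-x | no odd-y = λ eq → contradiction (even-gap k {x} {y} even-x eq) odd-y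
... | no odd-x | yes even-y = λ eq → contradiction (even-gap k {y} {x} even-y (sym eq)) odd-x

partner-InCP : ∀ {k n x} → 2 ∣ n → InCP k n x → InCP k n (partner k x)
partner-InCP {k} {n} 2∣n x∈ with InCP⇒offset x∈
... | α , α<n , refl with even? (k + + α - k)
...   | yes even = subst (InCP k n) (sym (step-up k (+ α))) (offset⇒InCP 1+α<n)
  where
  step-up : ∀ k a → k + a + + 1 ≡ k + (+ 1 + a)
  step-up = solve-∀
  2∣α : 2 ∣ α
  2∣α = ℤ∣.∣⇒∣ᵤ (subst Even (i+j-i≡j k (+ α)) even)
  1+α<n : suc α < n
  1+α<n = ℕ.≤∧≢⇒< α<n λ 1+α≡n →
    ¬2∣1 (ℕ.∣m+n∣m⇒∣n (subst (2 ∣_) (trans (sym 1+α≡n) (ℕ.+-comm 1 α)) 2∣n) 2∣α)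
...   | no odd with α
...     | zero = contradiction (subst Even (sym (i+j-i≡j k (+ 0))) (divides (+ 0) refl)) odd
...     | suc β =
  subst (InCP k n) (sym (step-down k (+ β))) (offset⇒InCP (ℕ.<-trans (ℕ.n<1+n β) α<n))
  where
  step-down : ∀ k b → k + (+ 1 + b) - + 1 ≡ k + b
  step-down = solve-∀

-- An even vertex is followed by an odd one, so q ↦ next q on even positions and q ↦ (position of
-- partner k (v q)) on odd positions is injective; two consecutive odd vertices would leave the
-- second position outside its image.
hamiltonian⇒¬odd∧odd-next : ∀ {k m v} → 2 ∣ suc m → IsHamCycleCP k (suc m) v →
  ∀ p → ¬ (Odd (v p) × Odd (v (next p)))
hamiltonian⇒¬odd∧odd-next {k} {m} {v} 2∣n (v∈ , v-injective , v-onto , cyc) p (odd-p , odd-next-p) =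
  injective⇒¬omits step-injective (next p) step≢next-p
  where
  even⇒odd-next : ∀ q → Even (v q) → Odd (v (next q))
  even⇒odd-next q even-q even-next-q =
    even∧even⇒gcd≢1 even-q even-next-q (proj₂ (cycleAdj⇒Adj-next {v = v} cyc q))

  τ : Fin (suc m) → Fin (suc m)
  τ q = proj₁ (v-onto (partner k (v q)) (partner-InCP 2∣n (v∈ q)))

  v∘τ : ∀ q → v (τ q) ≡ partner k (v q)
  v∘τ q = proj₂ (v-onto (partner k (v q)) (partner-InCP 2∣n (v∈ q)))

  odd⇒even-τ : ∀ q → Odd (v q) → Even (v (τ q))
  odd⇒even-τ q odd-q = subst Even (sym (v∘τ q)) (odd⇒even-partner k odd-q)

  τ-injective : Injective _≡_ _≡_ τ
  τ-injective {q} {r} eq =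
    v-injective (partner-injective k (trans (sym (v∘τ q)) (trans (cong v eq) (v∘τ r))))

  step : Fin (suc m) → Fin (suc m)
  step q with even? (v q)
  ... | yes _ = next q
  ... | no _ = τ q

  step-injective : Injective _≡_ _≡_ step
  step-injective {q} {r} with even? (v q) | even? (v r)
  ... | yes _ | yes _ = next-injective
  ... | no _ | no _ = τ-injective
  ... | yes even-q | no odd-r = λ eq →
    contradiction (subst (λ s → Even (v s)) (sym eq) (odd⇒even-τ r odd-r)) (even⇒odd-next q even-q)
  ... | no odd-q | yes even-r = λ eq →
    contradiction (subst (λ s → Even (v s)) eq (odd⇒even-τ q odd-q)) (even⇒odd-next r even-r)

  step≢next-p : ∀ q → step q ≢ next p
  step≢next-p q with even? (v q)
  ... | yes even-q = λ eq → odd-p (subst (λ s → Even (v s)) (next-injective eq) even-q)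
  ... | no odd-q = λ eq → odd-next-p (subst (λ s → Even (v s)) eq (odd⇒even-τ q odd-q))

isHamCycleCP-resp-≗ : ∀ {k k′ m} {v w : Fin (suc m) → ℤ} → k ≡ k′ → v ≗ w →
  IsHamCycleCP k (suc m) v → IsHamCycleCP k′ (suc m) w
isHamCycleCP-resp-≗ {v = v} {w} refl v≗w (v∈ , v-injective , v-onto , cyc) =
  (λ i → subst (InCP _ _) (v≗w i) (v∈ i)) ,
  (λ {i} {j} eq → v-injective (trans (v≗w i) (trans eq (sym (v≗w j))))) ,
  (λ x x∈ → let i , vi≡x = v-onto x x∈ in i , trans (sym (v≗w i)) vi≡x) ,
  Adj-next⇒cycleAdj (λ p → subst₂ Adj (v≗w p) (v≗w (next p)) (cycleAdj⇒Adj-next {v = v} cyc p))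

isHamCycleCP-+ : ∀ {k m v} s → 2 ∣ suc m → Odd s → DivisibleByOddPrimesBelow (suc m) s →
  IsHamCycleCP k (suc m) v → IsHamCycleCP (k + s) (suc m) (λ i → v i + s)
isHamCycleCP-+ {k} {m} {v} s 2∣n odd-s s-div ham@(v∈ , v-injective , v-onto , cyc) =
  (λ i → InCP-+ s (v∈ i)) ,
  (λ {i} {j} eq → v-injective (+-cancelʳ s (v i) (v j) eq)) ,
  onto ,
  Adj-next⇒cycleAdj shifted-adj
  where
  onto : ∀ y → InCP (k + s) (suc m) y → ∃ λ i → v i + s ≡ y
  onto y y∈ with v-onto (y - s)
    (subst (λ k′ → InCP k′ (suc m) (y - s)) (i+j-j≡i k s) (InCP-+ (- s) y∈))
  ... | i , vi≡y-s = i , trans (cong (_+ s) vi≡y-s) (i-j+j≡i y s)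

  shifted-adj : ∀ p → Adj (v p + s) (v (next p) + s)
  shifted-adj p with cycleAdj⇒Adj-next {v = v} cyc p
  ... | vp≢vq , gcd≡1 =
    (λ eq → vp≢vq (+-cancelʳ s _ _ eq)) ,
    gcd[+s,+s]≡1 odd-s s-div vp≢vq (InCP⇒∣-∣<n (v∈ p) (v∈ (next p)))
      (hamiltonian⇒¬odd∧odd-next 2∣n ham p) gcd≡1

-- 4 ≤ n only rules out n = 0.
lemma2p5 : (n : ℕ) → 4 ≤ n → 2 ∣ n → (k : ℤ) → (v : Fin n → ℤ) →
    IsHamCycleCP k n v ⇔ IsHamCycleCP (k + + φ n) n (λ i → v i + + φ n)
lemma2p5 n@(suc _) _ 2∣n k v = mk⇔ (isHamCycleCP-+ (+ φ n) 2∣n odd-φ φ-div) unshift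
  where
  odd-φ : Odd (+ φ n)
  odd-φ even-φ = ¬2∣φ n (ℤ∣.∣⇒∣ᵤ even-φ)

  φ-div : DivisibleByOddPrimesBelow n (+ φ n)
  φ-div pp p≢2 p<n = ℤ∣.∣ᵤ⇒∣ (odd-prime∣φ n pp p≢2 p<n)

  unshift : IsHamCycleCP (k + + φ n) n (λ i → v i + + φ n) → IsHamCycleCP k n v
  unshift ham = isHamCycleCP-resp-≗ (i+j-j≡i k (+ φ n)) (λ i → i+j-j≡i (v i) (+ φ n))
    (isHamCycleCP-+ (- + φ n) 2∣n (odd-neg odd-φ) (DivisibleByOddPrimesBelow-neg φ-div) ham)
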